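{- Let $L$ be a first-order language whose set of function symbols is $L_{\mathrm{alg}}$ and which contains an $n$-ary relation symbol $R$. Let $\mathcal{K}$ be a class of $L$-structures such that $R$ is definable by conjunctions of identities over $\mathcal{K}$. If $\mathcal{K}_{\mathrm{alg}}$ is a variety, then the forgetful functor $U:\mathbf{K}_{\mathrm{alg}}\to\mathbf{K}_R$ has a left adjoint.
   Context: $R$ is definable by conjunctions of identities over $\mathcal{K}$ if there are $L$-terms $t_1,\dots,t_m,s_1,\dots,s_m$ in the variables $x_1,\dots,x_n$ such that $\mathcal{K}\models \forall x_1,\dots,x_n\,\bigl(R(x_1,\dots,x_n)\iff \bigwedge_{i=1}^m t_i(x_1,\dots,x_n)=s_i(x_1,\dots,x_n)\bigr)$. $\mathcal{K}_{\mathrm{alg}}$ and $\mathcal{K}_R$ denote the classes of reducts of members of $\mathcal{K}$ to $L_{\mathrm{alg}}$ and to $\{R\}$ respectively; $\mathbf{K}_{\mathrm{alg}}$ and $\mathbf{K}_R$ are the categories whose objects are these classes and whose morphisms are homomorphisms (for $\mathbf{K}_R$: maps preserving $R$). The functor $U$ sends $\mathbf{A}\in\mathcal{K}_{\mathrm{alg}}$ to $(A,R^{\mathbf{A}})$ where $\langle a_1,\dots,a_n\rangle\in R^{\mathbf{A}}$ iff $\mathbf{A}\models\bigwedge_{i=1}^m t_i(a_1,\dots,a_n)=s_i(a_1,\dots,a_n)$, and sends each homomorphism to the same underlying map. -}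

module Defs where

open import Level using (Level; _⊔_) renaming (suc to lsuc; zero to lzero)
open import Data.Nat using (ℕ)
open import Data.Fin using (Fin)
open import Data.Product using (Σ; Σ-syntax; _×_; _,_)
open import Relation.Binary.Bundles using (Setoid)
open import Relation.Binary.Structures using (IsEquivalence)

record Language : Set₁ where
  field
    Fun    : Set
    ar     : Fun → ℕ
    n      : ℕ           -- arity of the distinguished relation symbol R
    OtherR : Set         -- relation symbols of L other than R
    rar    : OtherR → ℕ

module _ (L : Language) where
  open Language L

  data Term {v : Level} (V : Set v) : Set v where
    var : V → Term V
    app : (f : Fun) → (Fin (ar f) → Term V) → Term V

  Identity : Set
  Identity = Σ[ k ∈ ℕ ] (Term (Fin k) × Term (Fin k))

  record Algebra (a : Level) : Set (lsuc a) where
    field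
      setoid : Setoid a a
    open Setoid setoid public
    field
      op      : (f : Fun) → (Fin (ar f) → Carrier) → Carrier
      op-cong : (f : Fun) {xs ys : Fin (ar f) → Carrier} →
                (∀ i → xs i ≈ ys i) → op f xs ≈ op f ys

  module _ {a : Level} (A : Algebra a) where
    open Algebra A

    eval : {v : Level} {V : Set v} → Term V → (V → Carrier) → Carrier
    eval (var v)    ρ = ρ v
    eval (app f ts) ρ = op f (λ i → eval (ts i) ρ)

    eval-cong : {v : Level} {V : Set v} (t : Term V) {ρ σ : V → Carrier} →
                (∀ v → ρ v ≈ σ v) → eval t ρ ≈ eval t σ
    eval-cong (var v)    e = e v
    eval-cong (app f ts) e = op-cong f (λ i → eval-cong (ts i) e)

    _⊨_ : Identity → Set a
    _⊨_ (k , t , s) = (ρ : Fin k → Carrier) → eval t ρ ≈ eval s ρ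

  record Hom {a : Level} (A B : Algebra a) : Set a where
    private
      module A = Algebra A
      module B = Algebra B
    field
      fun      : A.Carrier → B.Carrier
      fun-cong : ∀ {x y} → x A.≈ y → fun x B.≈ fun y
      fun-op   : (f : Fun) (xs : Fin (ar f) → A.Carrier) →
                 fun (A.op f xs) B.≈ B.op f (λ i → fun (xs i))

  record RStr (a : Level) : Set (lsuc a) where
    field
      setoid : Setoid a a
    open Setoid setoid public
    field
      rel      : (Fin n → Carrier) → Set a
      rel-resp : {xs ys : Fin n → Carrier} → (∀ i → xs i ≈ ys i) →
                 rel xs → rel ys

  record RHom {a : Level} (X Y : RStr a) : Set a where
    private
      module X = RStr X
      module Y = RStr Y
    field
      fun      : X.Carrier → Y.Carrier
      fun-cong : ∀ {x y} → x X.≈ y → fun x Y.≈ fun y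
      fun-rel  : (xs : Fin n → X.Carrier) → X.rel xs → Y.rel (λ i → fun (xs i))

  record Structure (a : Level) : Set (lsuc a) where
    field
      alg : Algebra a
    open Algebra alg public
    field
      relR      : (Fin n → Carrier) → Set a
      relR-resp : {xs ys : Fin n → Carrier} → (∀ i → xs i ≈ ys i) →
                  relR xs → relR ys
      relO      : (r : OtherR) → (Fin (rar r) → Carrier) → Set a
      relO-resp : (r : OtherR) {xs ys : Fin (rar r) → Carrier} →
                  (∀ i → xs i ≈ ys i) → relO r xs → relO r ys

  module _ {a k : Level} (K : Structure a → Set k) where

    K-alg : Algebra a → Set (lsuc a ⊔ k)
    K-alg A =
      Σ[ ρ ∈ ((Fin n → Algebra.Carrier A) → Set a) ]
      Σ[ ρr ∈ ({xs ys : Fin n → Algebra.Carrier A} →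
               (∀ i → Algebra._≈_ A (xs i) (ys i)) → ρ xs → ρ ys) ]
      Σ[ o ∈ ((r : OtherR) → (Fin (rar r) → Algebra.Carrier A) → Set a) ]
      Σ[ or ∈ ((r : OtherR) {xs ys : Fin (rar r) → Algebra.Carrier A} →
               (∀ i → Algebra._≈_ A (xs i) (ys i)) → o r xs → o r ys) ]
      K (record { alg = A ; relR = ρ ; relR-resp = ρr
                ; relO = o ; relO-resp = or })

    K-R : RStr a → Set (lsuc a ⊔ k)
    K-R X =
      Σ[ op ∈ ((f : Fun) → (Fin (ar f) → RStr.Carrier X) → RStr.Carrier X) ]
      Σ[ opc ∈ ((f : Fun) {xs ys : Fin (ar f) → RStr.Carrier X} →
                (∀ i → RStr._≈_ X (xs i) (ys i)) → RStr._≈_ X (op f xs) (op f ys)) ]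
      Σ[ o ∈ ((r : OtherR) → (Fin (rar r) → RStr.Carrier X) → Set a) ]
      Σ[ or ∈ ((r : OtherR) {xs ys : Fin (rar r) → RStr.Carrier X} →
               (∀ i → RStr._≈_ X (xs i) (ys i)) → o r xs → o r ys) ]
      K (record { alg = record { setoid = RStr.setoid X ; op = op ; op-cong = opc }
                ; relR = RStr.rel X ; relR-resp = RStr.rel-resp X
                ; relO = o ; relO-resp = or })

    DefinableByIdentities : (m : ℕ) (t s : Fin m → Term (Fin n)) → Set (lsuc a ⊔ k)
    DefinableByIdentities m t s =
      (M : Structure a) → K M → (xs : Fin n → Structure.Carrier M) →
      (Structure.relR M xs →
         ((i : Fin m) → Structure._≈_ M (eval (Structure.alg M) (t i) xs)
                                        (eval (Structure.alg M) (s i) xs)))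
      × (((i : Fin m) → Structure._≈_ M (eval (Structure.alg M) (t i) xs)
                                        (eval (Structure.alg M) (s i) xs))
         → Structure.relR M xs)

    IsVariety : Set (lsuc a ⊔ k)
    IsVariety =
      Σ[ E ∈ (Identity → Set) ]
        ((A : Algebra a) →
           (K-alg A → (e : Identity) → E e → _⊨_ A e)
         × (((e : Identity) → E e → _⊨_ A e) → K-alg A))

  module _ {a : Level} (m : ℕ) (t s : Fin m → Term (Fin n)) where

    U : Algebra a → RStr a
    U A = record
      { setoid   = Algebra.setoid A
      ; rel      = λ xs → (i : Fin m) → Algebra._≈_ A (eval A (t i) xs) (eval A (s i) xs)
      ; rel-resp = λ {xs} {ys} e p i →
          Algebra.trans A (Algebra.sym A (eval-cong A (t i) e))
            (Algebra.trans A (p i) (eval-cong A (s i) e))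
      }

    U-hom : {A B : Algebra a} → Hom A B → RStr.Carrier (U A) → RStr.Carrier (U B)
    U-hom h = Hom.fun h

    -- U has a left adjoint, expressed by universal arrows: every object X of
    -- K_R has a free object F X in K_alg with unit η : X → U (F X) such that
    -- every K_R-morphism X → U A (A ∈ K_alg) factors uniquely through η.
    HasLeftAdjoint : {k : Level} (K : Structure a → Set k) → Set (lsuc a ⊔ k)
    HasLeftAdjoint K =
      (X : RStr a) → K-R K X →
      Σ[ FX ∈ Algebra a ] K-alg K FX ×
      Σ[ η ∈ RHom X (U FX) ]
        ((A : Algebra a) → K-alg K A → (f : RHom X (U A)) →
          Σ[ g ∈ Hom FX A ]
            ((x : RStr.Carrier X) →
               Algebra._≈_ A (Hom.fun g (RHom.fun η x)) (RHom.fun f x))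
          × ((h : Hom FX A) →
               ((x : RStr.Carrier X) →
                  Algebra._≈_ A (Hom.fun h (RHom.fun η x)) (RHom.fun f x)) →
               (y : Algebra.Carrier FX) →
                  Algebra._≈_ A (Hom.fun h y) (Hom.fun g y)))

{-# OPTIONS --safe #-}
-- The left adjoint sends an {R}-structure X to the algebra presented, in the
-- variety Mod(E), by generators X and relations t_i(x̄) = s_i(x̄) for x̄ ∈ R^X:
-- terms over X modulo the least congruence containing the equality of X,
-- these relations and all substitution instances of E. The unit embeds the
-- generators, and a morphism X → U A lifts to F X → A by evaluating terms;
-- it respects the congruence because A satisfies E and f preserves R.
module Submission where

open import Defs
open import Level using (Level)
open import Data.Nat using (ℕ)
open import Data.Fin using (Fin)
open import Data.Product using (_,_; proj₁; proj₂)
open import Function using (_∘_)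
open import Relation.Binary.Bundles using (Setoid)
open import Relation.Binary.Core using (Rel)

module _ {L : Language} where
  open Language L

  infixl 8 _[_]
  _[_] : {v w : Level} {V : Set v} {W : Set w} → Term L V → (V → Term L W) → Term L W
  var x    [ σ ] = σ x
  app f ts [ σ ] = app f (λ i → ts i [ σ ])

  module _ {a : Level} (A : Algebra L a) where
    open Algebra A

    eval-[] : {v w : Level} {V : Set v} {W : Set w}
              (u : Term L V) (σ : V → Term L W) (ρ : W → Carrier) →
              eval L A (u [ σ ]) ρ ≈ eval L A u (λ x → eval L A (σ x) ρ)
    eval-[] (var x)    σ ρ = refl
    eval-[] (app f ts) σ ρ = op-cong f (λ i → eval-[] (ts i) σ ρ)

    ⊨-[] : {w : Level} {W : Set w} {k : ℕ} (u v : Term L (Fin k)) →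
           _⊨_ L A (k , u , v) → (σ : Fin k → Term L W) (ρ : W → Carrier) →
           eval L A (u [ σ ]) ρ ≈ eval L A (v [ σ ]) ρ
    ⊨-[] u v A⊨u≈v σ ρ =
      trans (eval-[] u σ ρ) (trans (A⊨u≈v _) (sym (eval-[] v σ ρ)))

module Presented {L : Language} {a : Level} (E : Identity L → Set) (G : Setoid a a)
                 (_≐_ : Rel (Term L (Setoid.Carrier G)) a) where
  open Language L
  private
    module G = Setoid G
    T = Term L G.Carrier

  infix 4 _~_
  data _~_ : Rel T a where
    refl     : ∀ {u} → u ~ u
    sym      : ∀ {u v} → u ~ v → v ~ u
    trans    : ∀ {u v w} → u ~ v → v ~ w → u ~ w
    var-cong : ∀ {x y} → x G.≈ y → var x ~ var y
    app-cong : ∀ f {us vs : Fin (ar f) → T} → (∀ i → us i ~ vs i) → app f us ~ app f vs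
    relation : ∀ {u v} → u ≐ v → u ~ v
    axiom    : ∀ {k u v} → E (k , u , v) → (σ : Fin k → T) → u [ σ ] ~ v [ σ ]

  F : Algebra L a
  F = record
    { setoid  = record
        { Carrier       = T
        ; _≈_           = _~_
        ; isEquivalence = record { refl = refl ; sym = sym ; trans = trans }
        }
    ; op      = app
    ; op-cong = app-cong
    }

  eval-F : {v : Level} {V : Set v} (u : Term L V) (σ : V → T) → eval L F u σ ~ u [ σ ]
  eval-F (var x)    σ = refl
  eval-F (app f us) σ = app-cong f (λ i → eval-F (us i) σ)

  F⊨E : (e : Identity L) → E e → _⊨_ L F e
  F⊨E (k , u , v) Ee σ = trans (eval-F u σ) (trans (axiom Ee σ) (sym (eval-F v σ)))

  module _ (A : Algebra L a) (A⊨E : (e : Identity L) → E e → _⊨_ L A e)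
           (f : G.Carrier → Algebra.Carrier A)
           (f-cong : ∀ {x y} → x G.≈ y → Algebra._≈_ A (f x) (f y))
           (f-resp : ∀ {u v} → u ≐ v → Algebra._≈_ A (eval L A u f) (eval L A v f)) where
    private
      module A = Algebra A

    lift-cong : ∀ {u v} → u ~ v → eval L A u f A.≈ eval L A v f
    lift-cong refl             = A.refl
    lift-cong (sym p)          = A.sym (lift-cong p)
    lift-cong (trans p q)      = A.trans (lift-cong p) (lift-cong q)
    lift-cong (var-cong x≈y)   = f-cong x≈y
    lift-cong (app-cong g ps)  = A.op-cong g (λ i → lift-cong (ps i))
    lift-cong (relation u≐v)   = f-resp u≐v
    lift-cong (axiom {k} {u} {v} Ee σ) = ⊨-[] A u v (A⊨E (k , u , v) Ee) σ f

    lift : Hom L F A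
    lift = record
      { fun      = λ u → eval L A u f
      ; fun-cong = lift-cong
      ; fun-op   = λ _ _ → A.refl
      }

    lift-unique : (h : Hom L F A) → (∀ x → Hom.fun h (var x) A.≈ f x) →
                  ∀ u → Hom.fun h u A.≈ Hom.fun lift u
    lift-unique h h∘var≈f (var x)    = h∘var≈f x
    lift-unique h h∘var≈f (app g us) =
      A.trans (Hom.fun-op h g us) (A.op-cong g (λ i → lift-unique h h∘var≈f (us i)))

module _ {L : Language} {a : Level} (m : ℕ) (t s : Fin m → Term L (Fin (Language.n L)))
         (X : RStr L a) where
  open Language L
  private
    module X = RStr X

  data RelationOf : Rel (Term L X.Carrier) a where
    related : (xs : Fin n → X.Carrier) → X.rel xs → (i : Fin m) →
              RelationOf (t i [ var ∘ xs ]) (s i [ var ∘ xs ])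

  RelationOf-sound : (A : Algebra L a) (f : RHom L X (U L m t s A)) →
                     ∀ {u v} → RelationOf u v →
                     Algebra._≈_ A (eval L A u (RHom.fun f)) (eval L A v (RHom.fun f))
  RelationOf-sound A f (related xs r i) =
    trans (eval-[] A (t i) _ _) (trans (RHom.fun-rel f xs r i) (sym (eval-[] A (s i) _ _)))
    where open Algebra A

  module FreeOver (E : Identity L → Set) where
    open Presented E X.setoid RelationOf public

    unit : RHom L X (U L m t s F)
    unit = record
      { fun      = var
      ; fun-cong = var-cong
      ; fun-rel  = λ xs r i →
          trans (eval-F (t i) _) (trans (relation (related xs r i)) (sym (eval-F (s i) _)))
      }

    module _ (A : Algebra L a) (A⊨E : (e : Identity L) → E e → _⊨_ L A e)
             (f : RHom L X (U L m t s A)) where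
      private
        module f = RHom f

      extend : Hom L F A
      extend = lift A A⊨E f.fun f.fun-cong (RelationOf-sound A f)

      extend-unique : (h : Hom L F A) → (∀ x → Algebra._≈_ A (Hom.fun h (var x)) (f.fun x)) →
                      ∀ u → Algebra._≈_ A (Hom.fun h u) (Hom.fun extend u)
      extend-unique = lift-unique A A⊨E f.fun f.fun-cong (RelationOf-sound A f)

theorem3p4 : {a k : Level} (L : Language) (K : Structure L a → Set k)
    (m : ℕ) (t s : Fin m → Term L (Fin (Language.n L))) →
    DefinableByIdentities L K m t s →
    IsVariety L K →
    HasLeftAdjoint L m t s K
theorem3p4 L K m t s _ (E , K-alg⇔⊨E) X _ =
  F , proj₂ (K-alg⇔⊨E F) F⊨E , unit , λ A A∈K f →
    let A⊨E = proj₁ (K-alg⇔⊨E A) A∈K in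
    extend A A⊨E f , (λ _ → Algebra.refl A) , extend-unique A A⊨E f
  where open FreeOver m t s X E
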